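{- Let $n\ge 1$ and $A\subseteq\{1,\dots,n\}$ nonempty. Let $\tilde{\mathcal G}$ be the playable game graph of $SN(n,A)$, and let $\tilde{\mathcal P}$ and $\tilde{\mathcal N}$ be the sets of P- and N-positions of the game played on $\tilde{\mathcal G}$. For any position $\mathbf p$ of $SN(n,A)$: if $\mathbf p$ is a P-position of $SN(n,A)$ then $r(\mathbf p)\in\tilde{\mathcal P}$, and if $\mathbf p$ is an N-position of $SN(n,A)$ then $r(\mathbf p)\in\tilde{\mathcal N}$.
   Context: The game $SN(n,A)$ is played on $n$ stacks of tokens; a position is $\mathbf p=(p_1,\dots,p_n)$ of nonnegative integers. A move consists of choosing some $\ell\in A$ and $\ell$ distinct stacks, each of height at least $1$, and removing exactly one token from each. Players alternate; a player unable to move loses (normal play); P-/N-positions are those from which the player to move loses/wins under optimal play. A terminal position is one with no legal move. For a position $\mathbf p$, let $\mathcal T(\mathbf p)$ be the set of terminal positions reachable from $\mathbf p$ by finite sequences of legal moves, $u_i(\mathbf p)=\min\{t_i:\mathbf t\in\mathcal T(\mathbf p)\}$, and $r(\mathbf p)=\mathbf p-u(\mathbf p)$ (the reduction of $\mathbf p$); $\mathbf p$ is reduced if $r(\mathbf p)=\mathbf p$. The playable game graph $\tilde{\mathcal G}$ has as vertices the reduced positions; from a reduced position $\mathbf q$, for each legal move of $SN(n,A)$ from $\mathbf q$ to a position $\mathbf q'$, there is a move in $\tilde{\mathcal G}$ from $\mathbf q$ to $r(\mathbf q')$. The game on $\tilde{\mathcal G}$ is played with the same alternating normal-play convention. -}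

module Defs where

open import Data.Nat using (ℕ; suc; _≤_; _+_)
open import Data.Fin using (Fin)
open import Data.Fin.Subset using (Subset; _∈_; _∉_; ∣_∣)
open import Data.Vec using (Vec; lookup)
open import Data.List using (List)
import Data.List.Membership.Propositional as LM
open import Data.Product using (Σ; ∃; ∃-syntax; _×_)
open import Relation.Binary.PropositionalEquality using (_≡_)
open import Relation.Binary.Construct.Closure.ReflexiveTransitive using (Star)
open import Relation.Nullary using (¬_)

-- A position of SN(n,A): heights of the n stacks.
Position : ℕ → Set
Position n = Vec ℕ n

-- The set A ⊆ {1,…,n} is given as a finite list of natural numbers.
-- A legal move of SN(n,A) from p to q: choose a set S of stacks with
-- |S| ∈ A, remove exactly one token from each stack in S (each such
-- stack must have height ≥ 1, enforced by p_i = q_i + 1), leave the rest.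
Move : ∀ {n} → List ℕ → Position n → Position n → Set
Move {n} A p q =
  Σ (Subset n) λ S →
    (LM._∈_ ∣ S ∣ A) ×
    (∀ (i : Fin n) → (i ∈ S → lookup p i ≡ suc (lookup q i))
                   × (i ∉ S → lookup q i ≡ lookup p i))

Reach : ∀ {n} → List ℕ → Position n → Position n → Set
Reach A = Star (Move A)

Terminal : ∀ {n} → List ℕ → Position n → Set
Terminal A t = ¬ (∃[ q ] Move A t q)

TermReach : ∀ {n} → List ℕ → Position n → Position n → Set
TermReach A p t = Reach A p t × Terminal A t

IsU : ∀ {n} → List ℕ → Position n → Fin n → ℕ → Set
IsU A p i m =
  (∃[ t ] (TermReach A p t × lookup t i ≡ m)) ×
  (∀ t → TermReach A p t → m ≤ lookup t i)

-- Red A p q  ⟺  q = r(p) = p − u(p).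
Red : ∀ {n} → List ℕ → Position n → Position n → Set
Red {n} A p q = ∀ (i : Fin n) → ∃[ m ] (IsU A p i m × lookup p i ≡ m + lookup q i)

Reduced : ∀ {n} → List ℕ → Position n → Set
Reduced A q = Red A q q

mutual
  data IsP {n} (A : List ℕ) (p : Position n) : Set where
    isP : (∀ q → Move A p q → IsN A q) → IsP A p

  data IsN {n} (A : List ℕ) (p : Position n) : Set where
    isN : ∀ q → Move A p q → IsP A q → IsN A p

GMove : ∀ {n} → List ℕ → Position n → Position n → Set
GMove A q q'' = Reduced A q × ∃[ q' ] (Move A q q' × Red A q' q'')

mutual
  data IsPG {n} (A : List ℕ) (q : Position n) : Set where
    isPG : Reduced A q → (∀ q'' → GMove A q q'' → IsNG A q'') → IsPG A q

  data IsNG {n} (A : List ℕ) (q : Position n) : Set where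
    isNG : Reduced A q → ∀ q'' → GMove A q q'' → IsPG A q'' → IsNG A q

module Submission where

-- Write p = u(p) + r(p).  Every position s reachable from p still reaches a
-- terminal position, which lies below s and (being reachable from p) above
-- u(p); so everything reachable from p dominates u(p).  Subtracting u(p) is
-- therefore a bijection between plays from p and plays from r(p) that move
-- the same stacks, matching terminal positions, the minima u and hence the
-- reductions: if p → p' corresponds to r(p) → q', then r(p') = r(q').  Since
-- every move removes a token, induction on the number of tokens transfers
-- the outcome of p to r(p) in the playable game graph.

open import Defs
open import Algebra.Properties.CommutativeSemigroup using (x∙yz≈y∙xz)
open import Data.Bool using (if_then_else_)
open import Data.Empty using (⊥-elim)
open import Data.Fin as Fin using (Fin)
open import Data.Fin.Properties using (all?)
open import Data.Fin.Subset using (Subset; _∈_; _∉_; ∣_∣; inside; outside)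
open import Data.Fin.Subset.Properties using (_∈?_)
open import Data.List using (List; []; _∷_; _++_; map; concatMap)
import Data.List.Membership.Propositional as List
open import Data.List.Relation.Unary.All as All using (All; _∷_; lookupAny)
open import Data.List.Relation.Unary.Any as Any using (Any; here; any?)
open import Data.List.Relation.Unary.Any.Properties using (++⁺ˡ; ++⁺ʳ; map⁺; concatMap⁺)
open import Data.Nat using (ℕ; suc; pred; _+_; _∸_; _≤_; _<_; _≟_; _≤?_; z≤n; s≤s; >-nonZero)
open import Data.Nat.Induction using (<-wellFounded)
open import Data.Nat.Properties
  using (≤-refl; ≤-reflexive; ≤-trans; ≤-totalOrder; n≤1+n; m<n+m; +-suc; +-assoc; +-identityʳ;
         +-cancelˡ-≡; +-monoʳ-≤; m+[n∸m]≡n; suc-pred; +-commutativeSemigroup)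
open import Data.List.Extrema ≤-totalOrder using (argmin; f[argmin]≤f[⊤]; f[argmin]≤f[xs])
open import Data.Product using (∃; ∃-syntax; _×_; _,_; proj₁; proj₂)
open import Data.Vec using ([]; _∷_; lookup; tabulate; sum; here; there)
open import Data.Vec.Properties using (lookup∘tabulate; tabulate∘lookup; tabulate-cong)
open import Function using (flip; _∘_; case_of_)
open import Induction.WellFounded using (WellFounded; Acc; acc; module Subrelation)
import Relation.Binary.Construct.On as On
open import Relation.Binary.Construct.Closure.ReflexiveTransitive using (Star; ε; _◅_; _◅◅_)
open import Relation.Binary.PropositionalEquality
  using (_≡_; _≢_; refl; sym; trans; cong; cong₂; subst; module ≡-Reasoning)
open import Relation.Nullary using (¬_; yes; no; does; contradiction)
open import Relation.Nullary.Decidable using (_×-dec_; _→-dec_)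

module NormalForms {X : Set} (_⟶_ : X → X → Set) (wf : WellFounded (flip _⟶_))
  (successors : ∀ x → List (∃ (x ⟶_)))
  (successors-complete : ∀ {x y} → x ⟶ y → Any ((y ≡_) ∘ proj₁) (successors x)) where

  Irreducible : X → Set
  Irreducible x = ¬ ∃ (x ⟶_)

  NormalForm : X → X → Set
  NormalForm x t = Star _⟶_ x t × Irreducible t

  MinimalValue : (X → ℕ) → X → ℕ → Set
  MinimalValue f x m = (∃[ t ] (NormalForm x t × f t ≡ m)) × (∀ t → NormalForm x t → m ≤ f t)

  normalForm : ∀ x → ∃ (NormalForm x)
  normalForm x = go x (wf x)
    where
    go : ∀ x → Acc (flip _⟶_) x → ∃ (NormalForm x)
    go x (acc rs) with successors x | successors-complete {x}
    ... | [] | complete = x , ε , λ (_ , x⟶y) → case complete x⟶y of λ ()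
    ... | (y , x⟶y) ∷ _ | _ with go y (rs x⟶y)
    ...   | t , y↠t , t-irr = t , x⟶y ◅ y↠t , t-irr

  minimalValue : ∀ f x → ∃ (MinimalValue f x)
  minimalValue f x = go x (wf x)
    where
    go : ∀ x → Acc (flip _⟶_) x → ∃ (MinimalValue f x)
    go x (acc rs) with successors x | successors-complete {x}
    ... | [] | complete = f x , (x , (ε , x-irr) , refl) , λ where
        t (ε , _) → ≤-refl
        t (x⟶y ◅ _ , _) → ⊥-elim (x-irr (_ , x⟶y))
      where
      x-irr : Irreducible x
      x-irr (_ , x⟶y) = case complete x⟶y of λ ()
    ... | s ∷ ss | complete = value best , witness (proj₁ (proj₂ (below best))) , lower-bound
      where
      below : (s : ∃ (x ⟶_)) → ∃ (MinimalValue f (proj₁ s))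
      below (y , x⟶y) = go y (rs x⟶y)
      value : ∃ (x ⟶_) → ℕ
      value s = proj₁ (below s)
      best : ∃ (x ⟶_)
      best = argmin value s ss
      best-minimal : All (λ s → value best ≤ value s) (s ∷ ss)
      best-minimal = f[argmin]≤f[⊤] {f = value} s ss ∷ f[argmin]≤f[xs] s ss
      witness : ∃[ t ] (NormalForm (proj₁ best) t × f t ≡ value best) →
                ∃[ t ] (NormalForm x t × f t ≡ value best)
      witness (t , (y↠t , t-irr) , ft≡m) = t , (proj₂ best ◅ y↠t , t-irr) , ft≡m
      lower-bound : ∀ t → NormalForm x t → value best ≤ f t
      lower-bound t (ε , x-irr) = ⊥-elim (x-irr s)
      lower-bound t (x⟶y ◅ y↠t , t-irr) with lookupAny best-minimal (complete x⟶y)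
      ... | best≤s , y≡s = ≤-trans best≤s
        (proj₂ (proj₂ (below _)) t (subst (λ y → Star _⟶_ y t) y≡s y↠t , t-irr))

Removal : ∀ {n} → Subset n → Position n → Position n → Set
Removal {n} S p q =
  ∀ (i : Fin n) → (i ∈ S → lookup p i ≡ suc (lookup q i)) × (i ∉ S → lookup q i ≡ lookup p i)

removal-tail : ∀ {n s x y} {S : Subset n} {p q : Position n} →
               Removal (s ∷ S) (x ∷ p) (y ∷ q) → Removal S p q
removal-tail r i =
  proj₁ (r (Fin.suc i)) ∘ there , λ i∉S → proj₂ (r (Fin.suc i)) λ { (there i∈S) → i∉S i∈S }

removal-sum : ∀ {n} (S : Subset n) (p q : Position n) → Removal S p q → sum p ≡ ∣ S ∣ + sum q
removal-sum [] [] [] _ = refl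
removal-sum (inside ∷ S) (x ∷ p) (y ∷ q) r = begin
  x + sum p               ≡⟨ cong₂ _+_ (proj₁ (r Fin.zero) here) (removal-sum S p q (removal-tail r)) ⟩
  suc y + (∣ S ∣ + sum q) ≡⟨ cong suc (x∙yz≈y∙xz +-commutativeSemigroup y ∣ S ∣ (sum q)) ⟩
  suc ∣ S ∣ + (y + sum q) ∎
  where open ≡-Reasoning
removal-sum (outside ∷ S) (x ∷ p) (y ∷ q) r = begin
  x + sum p               ≡⟨ cong₂ _+_ (sym (proj₂ (r Fin.zero) λ ())) (removal-sum S p q (removal-tail r)) ⟩
  y + (∣ S ∣ + sum q)     ≡⟨ x∙yz≈y∙xz +-commutativeSemigroup y ∣ S ∣ (sum q) ⟩
  ∣ S ∣ + (y + sum q)     ∎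
  where open ≡-Reasoning

height-after : ∀ {n} → Subset n → Position n → Fin n → ℕ
height-after S p i = if does (i ∈? S) then pred (lookup p i) else lookup p i

remove : ∀ {n} → Subset n → Position n → Position n
remove S p = tabulate (height-after S p)

module _ {n : ℕ} (S : Subset n) (p : Position n) where

  removal-≤ : ∀ {q} → Removal S p q → ∀ i → lookup q i ≤ lookup p i
  removal-≤ r i with i ∈? S
  ... | yes i∈S = subst (_ ≤_) (sym (proj₁ (r i) i∈S)) (n≤1+n _)
  ... | no  i∉S = ≤-reflexive (proj₂ (r i) i∉S)

  removal-remove : (∀ i → i ∈ S → 1 ≤ lookup p i) → Removal S p (remove S p)
  removal-remove occupied i rewrite lookup∘tabulate (height-after S p) i with i ∈? S
  ... | yes i∈S = (λ _ → sym (suc-pred _ {{>-nonZero (occupied i i∈S)}})) ,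
                  λ i∉S → contradiction i∈S i∉S
  ... | no  i∉S = (λ i∈S → contradiction i∈S i∉S) , λ _ → refl

  removal⇒remove : ∀ {q} → Removal S p q → q ≡ remove S p
  removal⇒remove {q} r = trans (sym (tabulate∘lookup q)) (tabulate-cong pointwise)
    where
    pointwise : ∀ i → lookup q i ≡ height-after S p i
    pointwise i with i ∈? S
    ... | yes i∈S = cong pred (sym (proj₁ (r i) i∈S))
    ... | no  i∉S = proj₂ (r i) i∉S

subsets : ∀ n → List (Subset n)
subsets 0 = [] ∷ []
subsets (suc n) = map (inside ∷_) (subsets n) ++ map (outside ∷_) (subsets n)

∈-subsets : ∀ {n} (S : Subset n) → S List.∈ subsets n
∈-subsets [] = here refl
∈-subsets (inside ∷ S) = ++⁺ˡ (map⁺ (Any.map (cong (inside ∷_)) (∈-subsets S)))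
∈-subsets {suc n} (outside ∷ S) =
  ++⁺ʳ (map (inside ∷_) (subsets n)) (map⁺ (Any.map (cong (outside ∷_)) (∈-subsets S)))

module SN {n : ℕ} (A : List ℕ) where

  moves-via : (p : Position n) (S : Subset n) → List (∃ (Move A p))
  moves-via p S with any? (∣ S ∣ ≟_) A ×-dec all? (λ i → i ∈? S →-dec 1 ≤? lookup p i)
  ... | yes (|S|∈A , occupied) = (remove S p , S , |S|∈A , removal-remove S p occupied) ∷ []
  ... | no _                   = []

  moves-via-complete : ∀ {p q : Position n} (S : Subset n) → ∣ S ∣ List.∈ A → Removal S p q →
                       Any ((q ≡_) ∘ proj₁) (moves-via p S)
  moves-via-complete {p} S |S|∈A r
    with any? (∣ S ∣ ≟_) A ×-dec all? (λ i → i ∈? S →-dec 1 ≤? lookup p i)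
  ... | yes _       = here (removal⇒remove S p r)
  ... | no illegal = contradiction (|S|∈A , occupied) illegal
    where
    occupied : ∀ i → i ∈ S → 1 ≤ lookup p i
    occupied i i∈S = subst (1 ≤_) (sym (proj₁ (r i) i∈S)) (s≤s z≤n)

  successors : (p : Position n) → List (∃ (Move A p))
  successors p = concatMap (moves-via p) (subsets n)

  successors-complete : ∀ {p q : Position n} → Move A p q → Any ((q ≡_) ∘ proj₁) (successors p)
  successors-complete (S , |S|∈A , r) =
    concatMap⁺ (moves-via _) (Any.map (λ { refl → moves-via-complete S |S|∈A r }) (∈-subsets S))

  reach-≤ : ∀ {p t : Position n} → Reach A p t → ∀ i → lookup t i ≤ lookup p i
  reach-≤ ε i = ≤-refl
  reach-≤ {p} (_◅_ {j = q} (S , _ , r) q↠t) i = ≤-trans (reach-≤ q↠t i) (removal-≤ S p {q} r i)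

  record Shifted (c : Fin n → ℕ) (p q : Position n) : Set where
    constructor shifted
    field offset : ∀ i → lookup p i ≡ c i + lookup q i

  record Floor (c : Fin n → ℕ) (p : Position n) : Set where
    constructor floor
    field below : ∀ {s} → Reach A p s → ∀ i → c i ≤ lookup s i

  floor-reach : ∀ {c} {p s : Position n} → Floor c p → Reach A p s → Floor c s
  floor-reach (floor below) p↠s = floor (below ∘ (p↠s ◅◅_))

  module _ {c : Fin n → ℕ} {p q p' q' : Position n} (sh : Shifted c p q) (sh' : Shifted c p' q') where
    open Shifted

    move-up : Move A q q' → Move A p p'
    move-up (S , |S|∈A , r) = S , |S|∈A , λ i →
      (λ i∈S → trans (offset sh i) (trans (cong (c i +_) (proj₁ (r i) i∈S))
                                          (trans (+-suc (c i) _) (cong suc (sym (offset sh' i)))))) ,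
      (λ i∉S → trans (offset sh' i) (trans (cong (c i +_) (proj₂ (r i) i∉S)) (sym (offset sh i))))

    move-down : Move A p p' → Move A q q'
    move-down (S , |S|∈A , r) = S , |S|∈A , λ i →
      (λ i∈S → +-cancelˡ-≡ (c i) _ _ (trans (sym (offset sh i)) (trans (proj₁ (r i) i∈S)
                                         (trans (cong suc (offset sh' i)) (sym (+-suc (c i) _)))))) ,
      (λ i∉S → +-cancelˡ-≡ (c i) _ _
                 (trans (sym (offset sh' i)) (trans (proj₂ (r i) i∉S) (offset sh i))))

  open Shifted
  open Floor

  shift : (Fin n → ℕ) → Position n → Position n
  shift c q = tabulate λ i → c i + lookup q i

  unshift : (Fin n → ℕ) → Position n → Position n
  unshift c p = tabulate λ i → lookup p i ∸ c i

  module _ {c : Fin n → ℕ} where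

    shifted-shift : ∀ {q} → Shifted c (shift c q) q
    shifted-shift {q} = shifted (lookup∘tabulate (λ i → c i + lookup q i))

    shifted-unshift : ∀ {p} → (∀ i → c i ≤ lookup p i) → Shifted c p (unshift c p)
    shifted-unshift {p} c≤p = shifted λ i →
      trans (sym (m+[n∸m]≡n (c≤p i)))
            (cong (c i +_) (sym (lookup∘tabulate (λ j → lookup p j ∸ c j) i)))

    lift-move : ∀ {p q q'} → Shifted c p q → Move A q q' → ∃[ p' ] (Move A p p' × Shifted c p' q')
    lift-move {q' = q'} sh q→q' = shift c q' , move-up sh (shifted-shift {q'}) q→q' , shifted-shift

    lower-move : ∀ {p q p'} → Floor c p → Shifted c p q → Move A p p' →
                 ∃[ q' ] (Move A q q' × Shifted c p' q')
    lower-move {p' = p'} fl sh p→p' = unshift c p' , move-down sh sh' p→p' , sh'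
      where
      sh' : Shifted c p' (unshift c p')
      sh' = shifted-unshift (below fl {p'} (p→p' ◅ ε))

    lift-reach : ∀ {p q t} → Shifted c p q → Reach A q t → ∃[ s ] (Reach A p s × Shifted c s t)
    lift-reach sh ε = _ , ε , sh
    lift-reach sh (q→q' ◅ q'↠t) with lift-move sh q→q'
    ... | p' , p→p' , sh' with lift-reach sh' q'↠t
    ...   | s , p'↠s , sh'' = s , p→p' ◅ p'↠s , sh''

    lower-reach : ∀ {p q s} → Floor c p → Shifted c p q → Reach A p s →
                  ∃[ t ] (Reach A q t × Shifted c s t)
    lower-reach fl sh ε = _ , ε , sh
    lower-reach fl sh (p→p' ◅ p'↠s) with lower-move fl sh p→p'
    ... | q' , q→q' , sh' with lower-reach (floor-reach fl (p→p' ◅ ε)) sh' p'↠s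
    ...   | t , q'↠t , sh'' = t , q→q' ◅ q'↠t , sh''

    lower-terminal : ∀ {p q} → Shifted c p q → Terminal A p → Terminal A q
    lower-terminal sh p-term (q' , q→q') =
      p-term (shift c q' , proj₁ (proj₂ (lift-move {q' = q'} sh q→q')))

    lift-terminal : ∀ {p q} → Floor c p → Shifted c p q → Terminal A q → Terminal A p
    lift-terminal fl sh q-term (p' , p→p') =
      q-term (unshift c p' , proj₁ (proj₂ (lower-move {p' = p'} fl sh p→p')))

    lift-IsU : ∀ {p q i m} → Floor c p → Shifted c p q → IsU A q i m → IsU A p i (c i + m)
    lift-IsU {p} {q} {i} {m} fl sh ((t , (q↠t , t-term) , tᵢ≡m) , minimal) = witness , lower-bound
      where
      witness : ∃[ s ] (TermReach A p s × lookup s i ≡ c i + m)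
      witness with lift-reach sh q↠t
      ... | s , p↠s , sh' = s , (p↠s , lift-terminal (floor-reach fl p↠s) sh' t-term) ,
                            trans (offset sh' i) (cong (c i +_) tᵢ≡m)
      lower-bound : ∀ s → TermReach A p s → c i + m ≤ lookup s i
      lower-bound s (p↠s , s-term) with lower-reach fl sh p↠s
      ... | t , q↠t , sh' = subst (c i + m ≤_) (sym (offset sh' i))
                              (+-monoʳ-≤ (c i) (minimal t (q↠t , lower-terminal sh' s-term)))

    lift-Red : ∀ {p q r} → Floor c p → Shifted c p q → Red A q r → Red A p r
    lift-Red fl sh red i with red i
    ... | m , uᵢ , qᵢ≡m+rᵢ = c i + m , lift-IsU fl sh uᵢ ,
                             trans (offset sh i) (trans (cong (c i +_) qᵢ≡m+rᵢ) (sym (+-assoc (c i) m _)))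

  module Terminating (A-positive : All (1 ≤_) A) where

    move-shrinks : ∀ {p q : Position n} → Move A p q → sum q < sum p
    move-shrinks {p} {q} (S , |S|∈A , r) =
      subst (sum q <_) (sym (removal-sum S p q r)) (m<n+m (sum q) (All.lookup A-positive |S|∈A))

    moves-wellFounded : WellFounded (flip (Move A))
    moves-wellFounded =
      Subrelation.wellFounded (λ {q} {p} → move-shrinks {p} {q}) (On.wellFounded sum <-wellFounded)

    open NormalForms (Move A) moves-wellFounded successors successors-complete

    floor-IsU : ∀ {c p} → (∀ i → IsU A p i (c i)) → Floor c p
    floor-IsU u = floor λ {s} p↠s i →
      let t , s↠t , t-term = normalForm s
      in ≤-trans (proj₂ (u i) t (p↠s ◅◅ s↠t , t-term)) (reach-≤ s↠t i)

    reduction : (p : Position n) → ∃ (Red A p)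
    reduction p = unshift u p , λ i → u i , u-IsU i , offset u-shifted i
      where
      u : Fin n → ℕ
      u i = proj₁ (minimalValue (λ t → lookup t i) p)
      u-IsU : ∀ i → IsU A p i (u i)
      u-IsU i = proj₂ (minimalValue (λ t → lookup t i) p)
      u-shifted : Shifted u p (unshift u p)
      u-shifted = shifted-unshift (below (floor-IsU {u} {p} u-IsU) ε)

    module Decomposition {p q : Position n} (red : Red A p q) where

      u : Fin n → ℕ
      u i = proj₁ (red i)

      shifted-u : Shifted u p q
      shifted-u = shifted λ i → proj₂ (proj₂ (red i))

      floor-u : Floor u p
      floor-u = floor-IsU {u} {p} λ i → proj₁ (proj₂ (red i))

      reduced : Reduced A q
      reduced i with proj₁ (proj₁ (proj₂ (red i)))
      ... | s , (p↠s , s-term) , sᵢ≡uᵢ with lower-reach floor-u shifted-u p↠s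
      ...   | t , q↠t , sh = 0 , ((t , (q↠t , lower-terminal sh s-term) , tᵢ≡0) , λ _ _ → z≤n) , refl
        where
        tᵢ≡0 : lookup t i ≡ 0
        tᵢ≡0 = +-cancelˡ-≡ (u i) _ _
                 (trans (sym (offset sh i)) (trans sᵢ≡uᵢ (sym (+-identityʳ (u i)))))

      Red-after-move : ∀ {p' q' r} → Move A p p' → Shifted u p' q' → Red A q' r → Red A p' r
      Red-after-move {p'} {r = r} p→p' = lift-Red {r = r} (floor-reach floor-u (_◅_ {j = p'} p→p' ε))

    mutual
      P-reduces : ∀ {p q} → Acc (flip (Move A)) p → Red A p q → IsP A p → IsPG A q
      P-reduces {p} {q} (acc rs) red (isP moves-to-N) = isPG reduced q-loses
        where
        open Decomposition {p} {q} red
        q-loses : ∀ r → GMove A q r → IsNG A r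
        q-loses r (_ , q' , q→q' , red') with lift-move {q' = q'} shifted-u q→q'
        ... | p' , p→p' , sh =
          N-reduces (rs p→p') (Red-after-move {r = r} p→p' sh red') (moves-to-N p' p→p')

      N-reduces : ∀ {p q} → Acc (flip (Move A)) p → Red A p q → IsN A p → IsNG A q
      N-reduces {p} {q} (acc rs) red (isN p' p→p' p'∈P) =
        let q' , q→q' , sh = lower-move {p' = p'} floor-u shifted-u p→p'
            r , red' = reduction q'
        in isNG reduced r (reduced , q' , q→q' , red')
                (P-reduces (rs p→p') (Red-after-move {r = r} p→p' sh red') p'∈P)
        where open Decomposition {p} {q} red

proposition1 : (n : ℕ) → 1 ≤ n → (A : List ℕ) → A ≢ [] →
    All (λ ℓ → 1 ≤ ℓ × ℓ ≤ n) A →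
    (p : Position n) →
      (IsP A p → ∃[ q ] (Red A p q × IsPG A q)) ×
      (IsN A p → ∃[ q ] (Red A p q × IsNG A q))
proposition1 n _ A _ A-bounds p =
    (λ p∈P → q , red , P-reduces (moves-wellFounded p) red p∈P)
  , (λ p∈N → q , red , N-reduces (moves-wellFounded p) red p∈N)
  where
  open SN A
  open Terminating (All.map proj₁ A-bounds)
  q : Position n
  q = proj₁ (reduction p)
  red : Red A p q
  red = proj₂ (reduction p)
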